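{- Let $f\in\mathbb{Z}[x]$, $k\ge2$, and let $d>1$ be a square free integer. Then $$\sum_{\mathbf h\in(\mathbb{Z}/d\mathbb{Z})^{k-1}}\varepsilon_k(\mathbf h,d)=0.$$
   Context: For a prime $p$, $\Omega_p$ is the image of $f$ modulo $p$, $s_p=p/|\Omega_p|$, and for $\mathbf h=(h_1,\dots,h_{k-1})$, $N_k(\mathbf h,p)=|\{t\in\Omega_p:t+h_1,\dots,t+h_{k-1}\in\Omega_p\}|$ (depending only on $\mathbf h$ mod $p$). Define $\varepsilon_k(\mathbf h,p)=\frac{s_p^{k-1}N_k(\mathbf h,p)}{|\Omega_p|}-1$, and for square free $d$, $\varepsilon_k(\mathbf h,d)=\prod_{p\mid d}\varepsilon_k(\mathbf h,p)$, with $\varepsilon_k(\mathbf h,1)=1$. -}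

module Defs where

open import Data.Nat as ℕ using (ℕ; zero; suc)
open import Data.Nat.Divisibility using (_∣_; _∣?_)
open import Data.Nat.Primality using (Prime; prime?)
open import Data.Integer as ℤ using (ℤ; +_; _%ℕ_)
open import Data.Rational as ℚ using (ℚ; 0ℚ; 1ℚ)
open import Data.List using (List; []; _∷_; upTo; filter; map; length; concatMap; foldr; sum)
open import Data.List.Relation.Unary.Any using (any?)
open import Data.List.Relation.Unary.All using (all?)
open import Data.Vec as V using (Vec; []; _∷_)
open import Relation.Nullary.Decidable using (_×-dec_)
open import Relation.Binary.PropositionalEquality using (_≡_)
open import Data.Nat.Properties using (_≟_)
open import Data.Empty using (⊥)

-- A polynomial f ∈ ℤ[x], given by its list of coefficients
-- (constant term first): a₀ ∷ a₁ ∷ … represents a₀ + a₁ x + ….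
Poly : Set
Poly = List ℤ

eval : Poly → ℤ → ℤ
eval []       x = + 0
eval (a ∷ as) x = a ℤ.+ x ℤ.* eval as x

-- Residues modulo p are represented by ℕ values t with t < p, enumerated
-- as  upTo p = 0 ∷ 1 ∷ … ∷ (p-1).

Ω : (f : Poly) (p : ℕ) .{{_ : ℕ.NonZero p}} → List ℕ
Ω f p = filter (λ t → any? (λ x → (eval f (+ x) %ℕ p) ≟ t) (upTo p)) (upTo p)

card-Ω : (f : Poly) (p : ℕ) .{{_ : ℕ.NonZero p}} → ℕ
card-Ω f p = length (Ω f p)

N : (f : Poly) (p : ℕ) .{{_ : ℕ.NonZero p}} {m : ℕ} (h : Vec ℕ m) → ℕ
N f p h = length (filter
  (λ t → any? (λ x → (eval f (+ x) %ℕ p) ≟ t) (upTo p)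
       ×-dec all? (λ hi → any? (λ x → (eval f (+ x) %ℕ p) ≟ ℕ._%_ (t ℕ.+ hi) p) (upTo p))
                  (V.toList h))
  (upTo p))

_^ℚ_ : ℚ → ℕ → ℚ
q ^ℚ zero  = 1ℚ
q ^ℚ suc n = q ℚ.* (q ^ℚ n)

-- Here h ∈ (ℤ/pℤ)^{k-1}, i.e. a vector of length k-1 (k ≥ 2 is a
-- hypothesis of the theorem).  |Ω_p| ≥ 1 always (it contains f(0) mod p);
-- the zero clause below is an unreachable default needed for totality.
εp : (f : Poly) (k p : ℕ) .{{_ : ℕ.NonZero p}} (h : Vec ℕ (k ℕ.∸ 1)) → ℚ
εp f k p h with card-Ω f p
... | zero    = 0ℚ
... | suc c   = ((+ p ℚ./ suc c) ^ℚ (k ℕ.∸ 1)) ℚ.* (+ N f p h ℚ./ suc c) ℚ.- 1ℚ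

-- The primes dividing d, listed as p = 2 + q for q < d.
primeDivisorsPred : ℕ → List ℕ
primeDivisorsPred d = filter (λ q → prime? (2 ℕ.+ q) ×-dec ((2 ℕ.+ q) ∣? d)) (upTo d)

reduce : (p : ℕ) .{{_ : ℕ.NonZero p}} {m : ℕ} → Vec ℕ m → Vec ℕ m
reduce p = V.map (λ x → ℕ._%_ x p)

εd : (f : Poly) (k d : ℕ) (h : Vec ℕ (k ℕ.∸ 1)) → ℚ
εd f k d h = foldr (λ q acc → εp f k (2 ℕ.+ q) (reduce (2 ℕ.+ q) h) ℚ.* acc) 1ℚ
                   (primeDivisorsPred d)

allVecs : (d m : ℕ) → List (Vec ℕ m)
allVecs d zero    = [] ∷ []
allVecs d (suc m) = concatMap (λ x → map (x ∷_) (allVecs d m)) (upTo d)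

sumℚ : List ℚ → ℚ
sumℚ = foldr ℚ._+_ 0ℚ

SquareFree : ℕ → Set
SquareFree d = ∀ p → Prime p → (p ℕ.* p ∣ d) → ⊥

-- For one modulus p the sum is an exact count: Σ_h N_k(h,p) counts the
-- k-tuples (t, t+h_1, …, t+h_{k-1}) of points of Ω_p, so it equals |Ω_p|^k,
-- while there are p^{k-1} vectors h; the normalisation s_p^{k-1}/|Ω_p| in
-- ε_k(h,p) is exactly the one making Σ_h ε_k(h,p) = 0.  For squarefree
-- d = m·p with p prime, ε_k(h,d) = ε_k(h mod p, p)·ε_k(h mod m, m), and since
-- (ℤ/dℤ)^{k-1} ≅ (ℤ/pℤ)^{k-1} × (ℤ/mℤ)^{k-1} (Chinese remainder theorem) the
-- sum over h factors, with the vanishing factor for p.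

module Submission where

open import Algebra.Bundles using (CommutativeRing)
open import Data.Bool using (Bool; true; false; _∧_)
open import Data.Fin as Fin using (Fin; toℕ; fromℕ<; punchOut)
import Data.Fin.Properties as Fin
open import Data.Fin.Permutation using (Permutation′; permutation; _⟨$⟩ʳ_)
open import Data.Integer as ℤ using (+_; _%ℕ_)
import Data.Integer.Properties as ℤ
open import Data.List as List using (List; []; _∷_; map; upTo; applyUpTo; filter; length; concatMap; _++_)
import Data.List.Properties as List
open import Data.List.Membership.Propositional using (_∈_)
open import Data.List.Membership.Propositional.Properties using (∈-filter⁺; ∈-upTo⁺)
open import Data.List.Relation.Unary.All as All using (All; []; _∷_; all?)
open import Data.List.Relation.Unary.All.Properties using (all-filter)
open import Data.List.Relation.Unary.Any using (Any; any?)
open import Data.List.Relation.Unary.Unique.Propositional using (Unique; _∷_)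
open import Data.List.Relation.Unary.Unique.Propositional.Properties using (upTo⁺; filter⁺)
open import Data.Nat as ℕ using (ℕ; zero; suc; _<_; _≤_; _∸_; NonZero)
import Data.Nat.Properties as ℕ
open import Data.Nat.Coprimality using (Coprime; coprime-divisor)
open import Data.Nat.ListAction using (product)
open import Data.Nat.DivMod using (_%_; m≡m%n+[m/n]*n; m%n<n; [m+kn]%n≡m%n; m<n⇒m%n≡m; m∣n⇒o%n%m≡o%m)
open import Data.Nat.Divisibility
  using (_∣_; _∤_; _∣?_; divides; >⇒∤; ∣⇒≤; m∣m*n; *-monoˡ-∣; quotient; quotient≢0; m∣n⇒n≡quotient*m)
open import Data.Nat.Primality using (Prime; prime?; euclidsLemma; prime⇒irreducible; ¬prime[0]; ¬prime[1])
open import Data.Nat.Primality.Factorisation using (factorise)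
open import Data.Product using (∃; _×_; _,_; proj₁; proj₂)
open import Data.Rational as ℚ using (ℚ; 0ℚ; 1ℚ; _/_; _+_; _*_; _-_; fromℚᵘ)
import Data.Rational.Properties as ℚ
open import Data.Rational.Solver using (module +-*-Solver)
open import Data.Rational.Unnormalised as ℚᵘ using (mkℚᵘ; *≡*)
import Data.Rational.Unnormalised.Properties as ℚᵘ
open import Data.Sum using (inj₁; inj₂)
open import Data.Vec as Vec using (Vec; []; _∷_)
open import Function.Base using (_∘_; case_of_)
open import Function.Definitions using (Injective)
open import Relation.Binary.PropositionalEquality
open import Relation.Nullary using (does; yes; no; contradiction)
open import Relation.Nullary.Decidable using (_×-dec_)
open import Relation.Unary using (Decidable)
open import Algebra.Properties.Semiring.Sum (CommutativeRing.semiring ℚ.+-*-commutativeRing)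
  using (sum; ∑-distrib-+; ∑-comm; ∑-permute; sum-cong-≗; sum-replicate-zero; *-distribˡ-sum; *-distribʳ-sum)
open import Defs

open +-*-Solver
open ≡-Reasoning

ι : ℕ → ℚ
ι n = + n / 1

fromℚᵘ-homo-+ : ∀ x y → fromℚᵘ (x ℚᵘ.+ y) ≡ fromℚᵘ x + fromℚᵘ y
fromℚᵘ-homo-+ x y = ℚ.toℚᵘ-injective (ℚᵘ.≃-trans (ℚ.toℚᵘ-fromℚᵘ (x ℚᵘ.+ y))
  (ℚᵘ.≃-sym (ℚᵘ.≃-trans (ℚ.toℚᵘ-homo-+ (fromℚᵘ x) (fromℚᵘ y))
    (ℚᵘ.+-cong (ℚ.toℚᵘ-fromℚᵘ x) (ℚ.toℚᵘ-fromℚᵘ y)))))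

fromℚᵘ-homo-* : ∀ x y → fromℚᵘ (x ℚᵘ.* y) ≡ fromℚᵘ x * fromℚᵘ y
fromℚᵘ-homo-* x y = ℚ.toℚᵘ-injective (ℚᵘ.≃-trans (ℚ.toℚᵘ-fromℚᵘ (x ℚᵘ.* y))
  (ℚᵘ.≃-sym (ℚᵘ.≃-trans (ℚ.toℚᵘ-homo-* (fromℚᵘ x) (fromℚᵘ y))
    (ℚᵘ.*-cong (ℚ.toℚᵘ-fromℚᵘ x) (ℚ.toℚᵘ-fromℚᵘ y)))))

ι-+ : ∀ a b → ι (a ℕ.+ b) ≡ ι a + ι b
ι-+ a b = trans (ℚ./-cong (sym (cong₂ ℤ._+_ (ℤ.*-identityʳ (+ a)) (ℤ.*-identityʳ (+ b)))) refl)
                (fromℚᵘ-homo-+ (mkℚᵘ (+ a) 0) (mkℚᵘ (+ b) 0))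

n/d≡1/d*ι[n] : ∀ n d-1 → + n / suc d-1 ≡ (+ 1 / suc d-1) * ι n
n/d≡1/d*ι[n] n d-1 = trans (ℚ./-cong (sym (ℤ.*-identityˡ (+ n))) (cong suc (sym (ℕ.*-identityʳ d-1))))
                           (fromℚᵘ-homo-* (mkℚᵘ (+ 1) d-1) (mkℚᵘ (+ n) 0))

1/d*ι[d]≡1 : ∀ d-1 → (+ 1 / suc d-1) * ι (suc d-1) ≡ 1ℚ
1/d*ι[d]≡1 d-1 = trans (sym (n/d≡1/d*ι[n] (suc d-1) d-1))
  (ℚ.fromℚᵘ-cong {mkℚᵘ (+ suc d-1) d-1} {mkℚᵘ (+ 1) 0} (*≡* (ℤ.*-comm (+ suc d-1) (+ 1))))

^ℚ-distrib-* : ∀ x y n → (x * y) ^ℚ n ≡ x ^ℚ n * y ^ℚ n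
^ℚ-distrib-* x y zero    = sym (ℚ.*-identityˡ 1ℚ)
^ℚ-distrib-* x y (suc n) = trans (cong ((x * y) *_) (^ℚ-distrib-* x y n))
  (solve 4 (λ x y xⁿ yⁿ → (x :* y) :* (xⁿ :* yⁿ) := (x :* xⁿ) :* (y :* yⁿ)) refl x y (x ^ℚ n) (y ^ℚ n))

1^ℚn≡1 : ∀ n → 1ℚ ^ℚ n ≡ 1ℚ
1^ℚn≡1 zero    = refl
1^ℚn≡1 (suc n) = trans (ℚ.*-identityˡ _) (1^ℚn≡1 n)

^ℚ-cancel : ∀ x {y z} n → y * z ≡ 1ℚ → (y * x) ^ℚ n * (y * z ^ℚ suc n) ≡ x ^ℚ n
^ℚ-cancel x {y} {z} n yz≡1 = begin
  (y * x) ^ℚ n * (y * (z * z ^ℚ n))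
    ≡⟨ cong (_* (y * (z * z ^ℚ n))) (^ℚ-distrib-* y x n) ⟩
  y ^ℚ n * x ^ℚ n * (y * (z * z ^ℚ n))
    ≡⟨ solve 5 (λ xⁿ y yⁿ z zⁿ → yⁿ :* xⁿ :* (y :* (z :* zⁿ)) := xⁿ :* (yⁿ :* zⁿ) :* (y :* z))
               refl (x ^ℚ n) y (y ^ℚ n) z (z ^ℚ n) ⟩
  x ^ℚ n * (y ^ℚ n * z ^ℚ n) * (y * z)
    ≡⟨ cong₂ (λ a b → x ^ℚ n * a * b) yⁿzⁿ≡1 yz≡1 ⟩
  x ^ℚ n * 1ℚ * 1ℚ
    ≡⟨ trans (ℚ.*-identityʳ _) (ℚ.*-identityʳ _) ⟩
  x ^ℚ n ∎
  where
  yⁿzⁿ≡1 : y ^ℚ n * z ^ℚ n ≡ 1ℚ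
  yⁿzⁿ≡1 = trans (sym (^ℚ-distrib-* y z n)) (trans (cong (_^ℚ n) yz≡1) (1^ℚn≡1 n))

-- Finite sums

∑< : ℕ → (ℕ → ℚ) → ℚ
∑< n F = sum {n} (λ i → F (toℕ i))

∑<-cong : ∀ n {F G : ℕ → ℚ} → (∀ {x} → x < n → F x ≡ G x) → ∑< n F ≡ ∑< n G
∑<-cong n F≡G = sum-cong-≗ {n} (λ i → F≡G (Fin.toℕ<n i))

∑<-+ : ∀ a b F → ∑< (a ℕ.+ b) F ≡ ∑< a F + ∑< b (λ x → F (a ℕ.+ x))
∑<-+ zero    b F = sym (ℚ.+-identityˡ _)
∑<-+ (suc a) b F = trans (cong (_+_ (F 0)) (∑<-+ a b (F ∘ suc))) (sym (ℚ.+-assoc (F 0) _ _))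

∑<-* : ∀ m p F → ∑< (m ℕ.* p) F ≡ ∑< m (λ j → ∑< p (λ i → F (j ℕ.* p ℕ.+ i)))
∑<-* zero    p F = refl
∑<-* (suc m) p F = trans (∑<-+ p (m ℕ.* p) F) (cong (_+_ (∑< p F))
  (trans (∑<-* m p (λ x → F (p ℕ.+ x)))
         (∑<-cong m (λ {j} _ → ∑<-cong p (λ {i} _ → cong F (sym (ℕ.+-assoc p (j ℕ.* p) i)))))))

∑<-1 : ∀ n → ∑< n (λ _ → 1ℚ) ≡ ι n
∑<-1 zero    = refl
∑<-1 (suc n) = trans (cong (_+_ 1ℚ) (∑<-1 n)) (sym (ι-+ 1 n))

injective⇒surjective : ∀ {n} {f : Fin n → Fin n} → Injective _≡_ _≡_ f → ∀ y → ∃ λ x → f x ≡ y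
injective⇒surjective {suc n} {f} f-inj y with Fin.any? (λ x → f x Fin.≟ y)
... | yes hit = hit
... | no miss = contradiction (Fin.injective⇒≤ f-y-injective) ℕ.1+n≰n
  where
  y≢f : ∀ x → y ≢ f x
  y≢f x y≡fx = miss (x , sym y≡fx)
  f-y : Fin (suc n) → Fin n
  f-y x = punchOut (y≢f x)
  f-y-injective : Injective _≡_ _≡_ f-y
  f-y-injective {x} {x′} eq = f-inj (Fin.punchOut-injective (y≢f x) (y≢f x′) eq)

injective⇒permutation : ∀ {n} {f : Fin n → Fin n} → Injective _≡_ _≡_ f → Permutation′ n
injective⇒permutation {f = f} f-inj =
  permutation f (proj₁ ∘ surj) (proj₂ ∘ surj) (λ x → f-inj (proj₂ (surj (f x))))
  where surj = injective⇒surjective f-inj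

∑<-reindex : ∀ n (σ : ℕ → ℕ) → (∀ {x} → x < n → σ x < n) →
             (∀ {x y} → x < n → y < n → σ x ≡ σ y → x ≡ y) →
             ∀ F → ∑< n (λ x → F (σ x)) ≡ ∑< n F
∑<-reindex n σ σ<n σ-inj F = begin
  ∑< n (F ∘ σ)
    ≡⟨ sum-cong-≗ {n} (λ i → cong F (sym (Fin.toℕ-fromℕ< (σ<n (Fin.toℕ<n i))))) ⟩
  sum {n} (λ i → F (toℕ (π ⟨$⟩ʳ i)))
    ≡⟨ sym (∑-permute (F ∘ toℕ) π) ⟩
  ∑< n F ∎
  where
  σ̂ : Fin n → Fin n
  σ̂ i = fromℕ< (σ<n (Fin.toℕ<n i))
  σ̂-injective : Injective _≡_ _≡_ σ̂
  σ̂-injective {i} {j} σ̂i≡σ̂j = Fin.toℕ-injective (σ-inj (Fin.toℕ<n i) (Fin.toℕ<n j)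
    (trans (sym (Fin.toℕ-fromℕ< _)) (trans (cong toℕ σ̂i≡σ̂j) (Fin.toℕ-fromℕ< _))))
  π = injective⇒permutation σ̂-injective

module _ {A : Set} where

  sumℚ-map-*ˡ : ∀ c (G : A → ℚ) xs → sumℚ (map (λ x → c * G x) xs) ≡ c * sumℚ (map G xs)
  sumℚ-map-*ˡ c G []       = sym (ℚ.*-zeroʳ c)
  sumℚ-map-*ˡ c G (x ∷ xs) =
    trans (cong (_+_ (c * G x)) (sumℚ-map-*ˡ c G xs)) (sym (ℚ.*-distribˡ-+ c (G x) _))

  sumℚ-map-− : ∀ (F G : A → ℚ) xs →
               sumℚ (map (λ x → F x - G x) xs) ≡ sumℚ (map F xs) - sumℚ (map G xs)
  sumℚ-map-− F G []       = refl
  sumℚ-map-− F G (x ∷ xs) = trans (cong (_+_ (F x - G x)) (sumℚ-map-− F G xs))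
    (solve 4 (λ a b c d → (a :- b) :+ (c :- d) := (a :+ c) :- (b :+ d)) refl (F x) (G x) _ _)

  sumℚ-map-0 : ∀ xs → sumℚ (map (λ (_ : A) → 0ℚ) xs) ≡ 0ℚ
  sumℚ-map-0 []       = refl
  sumℚ-map-0 (x ∷ xs) = trans (ℚ.+-identityˡ _) (sumℚ-map-0 xs)

  sumℚ-map-∑< : ∀ n (F : A → ℕ → ℚ) xs →
                sumℚ (map (λ x → ∑< n (F x)) xs) ≡ ∑< n (λ t → sumℚ (map (λ x → F x t) xs))
  sumℚ-map-∑< n F []       = sym (sum-replicate-zero n)
  sumℚ-map-∑< n F (x ∷ xs) = trans (cong (_+_ (∑< n (F x))) (sumℚ-map-∑< n F xs))
    (sym (∑-distrib-+ {n} (F x ∘ toℕ) (λ i → sumℚ (map (λ y → F y (toℕ i)) xs))))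

  sumℚ-++ : ∀ xs ys → sumℚ (xs ++ ys) ≡ sumℚ xs + sumℚ ys
  sumℚ-++ []       ys = sym (ℚ.+-identityˡ _)
  sumℚ-++ (x ∷ xs) ys = trans (cong (_+_ x) (sumℚ-++ xs ys)) (sym (ℚ.+-assoc x _ _))

  sumℚ-map-concatMap : ∀ {B : Set} (G : B → ℚ) (g : A → List B) xs →
    sumℚ (map G (concatMap g xs)) ≡ sumℚ (map (λ x → sumℚ (map G (g x))) xs)
  sumℚ-map-concatMap G g []       = refl
  sumℚ-map-concatMap G g (x ∷ xs) = begin
    sumℚ (map G (g x ++ concatMap g xs))
      ≡⟨ cong sumℚ (List.map-++ G (g x) (concatMap g xs)) ⟩
    sumℚ (map G (g x) ++ map G (concatMap g xs))
      ≡⟨ sumℚ-++ (map G (g x)) _ ⟩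
    sumℚ (map G (g x)) + sumℚ (map G (concatMap g xs))
      ≡⟨ cong (_+_ (sumℚ (map G (g x)))) (sumℚ-map-concatMap G g xs) ⟩
    sumℚ (map G (g x)) + sumℚ (map (λ y → sumℚ (map G (g y))) xs) ∎

sumℚ-map-applyUpTo : ∀ (F : ℕ → ℚ) g n → sumℚ (map F (applyUpTo g n)) ≡ ∑< n (F ∘ g)
sumℚ-map-applyUpTo F g zero    = refl
sumℚ-map-applyUpTo F g (suc n) = cong (_+_ (F (g 0))) (sumℚ-map-applyUpTo F (g ∘ suc) n)

sumℚ-map-upTo : ∀ (F : ℕ → ℚ) n → sumℚ (map F (upTo n)) ≡ ∑< n F
sumℚ-map-upTo F = sumℚ-map-applyUpTo F (λ x → x)

∑ᵥ : (d n : ℕ) → (Vec ℕ n → ℚ) → ℚ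
∑ᵥ d n G = sumℚ (map G (allVecs d n))

∑ᵥ-cong : ∀ d n {G H : Vec ℕ n → ℚ} → (∀ h → G h ≡ H h) → ∑ᵥ d n G ≡ ∑ᵥ d n H
∑ᵥ-cong d n G≡H = cong sumℚ (List.map-cong G≡H (allVecs d n))

∑ᵥ-suc : ∀ d n (G : Vec ℕ (suc n) → ℚ) →
         ∑ᵥ d (suc n) G ≡ ∑< d (λ x → ∑ᵥ d n (λ h → G (x ∷ h)))
∑ᵥ-suc d n G = begin
  sumℚ (map G (concatMap (λ x → map (x ∷_) (allVecs d n)) (upTo d)))
    ≡⟨ sumℚ-map-concatMap G (λ x → map (x ∷_) (allVecs d n)) (upTo d) ⟩
  sumℚ (map (λ x → sumℚ (map G (map (x ∷_) (allVecs d n)))) (upTo d))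
    ≡⟨ sumℚ-map-upTo _ d ⟩
  ∑< d (λ x → sumℚ (map G (map (x ∷_) (allVecs d n))))
    ≡⟨ ∑<-cong d (λ {x} _ → cong sumℚ (sym (List.map-∘ {g = G} {f = x ∷_} (allVecs d n)))) ⟩
  ∑< d (λ x → ∑ᵥ d n (λ h → G (x ∷ h))) ∎

∏ : ∀ {n} → (ℕ → ℚ) → Vec ℕ n → ℚ
∏ g []      = 1ℚ
∏ g (x ∷ h) = g x * ∏ g h

∑ᵥ-∏ : ∀ d n (g : ℕ → ℚ) → ∑ᵥ d n (∏ g) ≡ ∑< d g ^ℚ n
∑ᵥ-∏ d zero    g = ℚ.+-identityʳ 1ℚ
∑ᵥ-∏ d (suc n) g = begin
  ∑ᵥ d (suc n) (∏ g)
    ≡⟨ ∑ᵥ-suc d n (∏ g) ⟩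
  ∑< d (λ x → ∑ᵥ d n (λ h → g x * ∏ g h))
    ≡⟨ ∑<-cong d (λ {x} _ → sumℚ-map-*ˡ (g x) (∏ {n} g) (allVecs d n)) ⟩
  ∑< d (λ x → g x * ∑ᵥ d n (∏ g))
    ≡⟨ ∑<-cong d (λ {x} _ → cong (_*_ (g x)) (∑ᵥ-∏ d n g)) ⟩
  ∑< d (λ x → g x * ∑< d g ^ℚ n)
    ≡⟨ sym (*-distribʳ-sum {d} (∑< d g ^ℚ n) (g ∘ toℕ)) ⟩
  ∑< d g ^ℚ suc n ∎

∏-1 : ∀ {n} (h : Vec ℕ n) → ∏ (λ _ → 1ℚ) h ≡ 1ℚ
∏-1 []      = refl
∏-1 (x ∷ h) = trans (ℚ.*-identityˡ _) (∏-1 h)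

∑ᵥ-1 : ∀ d n → ∑ᵥ d n (λ _ → 1ℚ) ≡ ι d ^ℚ n
∑ᵥ-1 d n = begin
  ∑ᵥ d n (λ _ → 1ℚ)           ≡⟨ ∑ᵥ-cong d n (λ h → sym (∏-1 h)) ⟩
  ∑ᵥ d n (∏ (λ _ → 1ℚ))       ≡⟨ ∑ᵥ-∏ d n (λ _ → 1ℚ) ⟩
  ∑< d (λ _ → 1ℚ) ^ℚ n        ≡⟨ cong (_^ℚ n) (∑<-1 d) ⟩
  ι d ^ℚ n                    ∎

-- Reindexing by residues

%≡%⇒∣∸ : ∀ a b m .{{_ : NonZero m}} → a % m ≡ b % m → m ∣ a ∸ b
%≡%⇒∣∸ a b m a%m≡b%m = divides (qa ∸ qb) (begin
  a ∸ b                                ≡⟨ cong₂ _∸_ (m≡m%n+[m/n]*n a m) b≡r+qb*m ⟩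
  (r ℕ.+ qa ℕ.* m) ∸ (r ℕ.+ qb ℕ.* m)  ≡⟨ ℕ.[m+n]∸[m+o]≡n∸o r (qa ℕ.* m) (qb ℕ.* m) ⟩
  qa ℕ.* m ∸ qb ℕ.* m                  ≡⟨ sym (ℕ.*-distribʳ-∸ m qa qb) ⟩
  (qa ∸ qb) ℕ.* m                      ∎)
  where
  r  = a % m
  qa = a ℕ./ m
  qb = b ℕ./ m
  b≡r+qb*m : b ≡ r ℕ.+ qb ℕ.* m
  b≡r+qb*m = trans (m≡m%n+[m/n]*n b m) (cong (ℕ._+ qb ℕ.* m) (sym a%m≡b%m))

∣∸∧<⇒≤ : ∀ {m i j} → m ∣ i ∸ j → i < m → i ≤ j
∣∸∧<⇒≤ {m} {i} {j} m∣i∸j i<m =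
  ℕ.m∸n≡0⇒m≤n (small m∣i∸j (ℕ.≤-<-trans (ℕ.m∸n≤m i j) i<m))
  where
  small : ∀ {x} → m ∣ x → x < m → x ≡ 0
  small {zero}  _   _   = refl
  small {suc x} m∣x x<m = contradiction m∣x (>⇒∤ x<m)

%-injective : ∀ m .{{_ : NonZero m}} (g : ℕ → ℕ) → (∀ {i j} → m ∣ g i ∸ g j → m ∣ i ∸ j) →
              ∀ {i j} → i < m → j < m → g i % m ≡ g j % m → i ≡ j
%-injective m g cancel {i} {j} i<m j<m gi≡gj = ℕ.≤-antisym
  (∣∸∧<⇒≤ (cancel (%≡%⇒∣∸ (g i) (g j) m gi≡gj)) i<m)
  (∣∸∧<⇒≤ (cancel (%≡%⇒∣∸ (g j) (g i) m (sym gi≡gj))) j<m)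

∑<-shift : ∀ p .{{_ : NonZero p}} t F → ∑< p (λ x → F ((t ℕ.+ x) % p)) ≡ ∑< p F
∑<-shift p t = ∑<-reindex p (λ x → (t ℕ.+ x) % p) (λ _ → m%n<n _ p)
  (%-injective p (t ℕ.+_) (λ {i} {j} → subst (p ∣_) (ℕ.[m+n]∸[m+o]≡n∸o t i j)))

∑<-CRT : ∀ m p .{{_ : NonZero m}} .{{_ : NonZero p}} → Coprime m p → ∀ a b →
         ∑< (m ℕ.* p) (λ x → a (x % p) * b (x % m)) ≡ ∑< p a * ∑< m b
∑<-CRT m p m⊥p a b = begin
  ∑< (m ℕ.* p) (λ x → a (x % p) * b (x % m))
    ≡⟨ ∑<-* m p (λ x → a (x % p) * b (x % m)) ⟩
  ∑< m (λ j → ∑< p (λ i → a ((j ℕ.* p ℕ.+ i) % p) * b ((j ℕ.* p ℕ.+ i) % m)))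
    ≡⟨ ∑<-cong m (λ {j} _ → ∑<-cong p (λ {i} i<p →
         cong₂ (λ r s → a r * b (s % m)) (block-offset j i<p) (ℕ.+-comm (j ℕ.* p) i))) ⟩
  ∑< m (λ j → ∑< p (λ i → a i * b ((i ℕ.+ j ℕ.* p) % m)))
    ≡⟨ ∑-comm {m} {p} (λ j i → a (toℕ i) * b ((toℕ i ℕ.+ toℕ j ℕ.* p) % m)) ⟩
  ∑< p (λ i → ∑< m (λ j → a i * b ((i ℕ.+ j ℕ.* p) % m)))
    ≡⟨ ∑<-cong p (λ {i} _ → sym (*-distribˡ-sum {m} (a i) (λ j → b ((i ℕ.+ toℕ j ℕ.* p) % m)))) ⟩
  ∑< p (λ i → a i * ∑< m (λ j → b ((i ℕ.+ j ℕ.* p) % m)))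
    ≡⟨ ∑<-cong p (λ {i} _ → cong (_*_ (a i)) (∑<-reindex m (λ j → (i ℕ.+ j ℕ.* p) % m)
         (λ _ → m%n<n _ m) (%-injective m (λ j → i ℕ.+ j ℕ.* p) (λ {j} {j′} → cancel i {j} {j′})) b)) ⟩
  ∑< p (λ i → a i * ∑< m b)
    ≡⟨ sym (*-distribʳ-sum {p} (∑< m b) (a ∘ toℕ)) ⟩
  ∑< p a * ∑< m b ∎
  where
  block-offset : ∀ j {i} → i < p → (j ℕ.* p ℕ.+ i) % p ≡ i
  block-offset j {i} i<p =
    trans (cong (_% p) (ℕ.+-comm (j ℕ.* p) i)) (trans ([m+kn]%n≡m%n i j p) (m<n⇒m%n≡m i<p))
  cancel : ∀ i {j j′} → m ∣ (i ℕ.+ j ℕ.* p) ∸ (i ℕ.+ j′ ℕ.* p) → m ∣ j ∸ j′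
  cancel i {j} {j′} m∣ = coprime-divisor m⊥p (subst (m ∣_) (begin
    (i ℕ.+ j ℕ.* p) ∸ (i ℕ.+ j′ ℕ.* p) ≡⟨ ℕ.[m+n]∸[m+o]≡n∸o i _ _ ⟩
    j ℕ.* p ∸ j′ ℕ.* p                 ≡⟨ sym (ℕ.*-distribʳ-∸ p j j′) ⟩
    (j ∸ j′) ℕ.* p                     ≡⟨ ℕ.*-comm (j ∸ j′) p ⟩
    p ℕ.* (j ∸ j′)                     ∎) m∣)

∑ᵥ-CRT : ∀ m p .{{_ : NonZero m}} .{{_ : NonZero p}} → Coprime m p → ∀ n (A B : Vec ℕ n → ℚ) →
         ∑ᵥ (m ℕ.* p) n (λ h → A (reduce p h) * B (reduce m h)) ≡ ∑ᵥ p n A * ∑ᵥ m n B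
∑ᵥ-CRT m p m⊥p zero    A B =
  trans (ℚ.+-identityʳ _) (sym (cong₂ _*_ (ℚ.+-identityʳ (A [])) (ℚ.+-identityʳ (B []))))
∑ᵥ-CRT m p m⊥p (suc n) A B = begin
  ∑ᵥ (m ℕ.* p) (suc n) (λ h → A (reduce p h) * B (reduce m h))
    ≡⟨ ∑ᵥ-suc (m ℕ.* p) n _ ⟩
  ∑< (m ℕ.* p) (λ x → ∑ᵥ (m ℕ.* p) n (λ h → A (x % p ∷ reduce p h) * B (x % m ∷ reduce m h)))
    ≡⟨ ∑<-cong (m ℕ.* p) (λ {x} _ → ∑ᵥ-CRT m p m⊥p n (A ∘ (x % p ∷_)) (B ∘ (x % m ∷_))) ⟩
  ∑< (m ℕ.* p) (λ x → ∑ᵥ p n (A ∘ (x % p ∷_)) * ∑ᵥ m n (B ∘ (x % m ∷_)))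
    ≡⟨ ∑<-CRT m p m⊥p (λ i → ∑ᵥ p n (A ∘ (i ∷_))) (λ j → ∑ᵥ m n (B ∘ (j ∷_))) ⟩
  ∑< p (λ i → ∑ᵥ p n (A ∘ (i ∷_))) * ∑< m (λ j → ∑ᵥ m n (B ∘ (j ∷_)))
    ≡⟨ sym (cong₂ _*_ (∑ᵥ-suc p n A) (∑ᵥ-suc m n B)) ⟩
  ∑ᵥ p (suc n) A * ∑ᵥ m (suc n) B ∎

-- The sum over (ℤ/pℤ)^{k-1} for a single modulus

𝟙 : Bool → ℚ
𝟙 true  = 1ℚ
𝟙 false = 0ℚ

𝟙-∧ : ∀ x y → 𝟙 (x ∧ y) ≡ 𝟙 x * 𝟙 y
𝟙-∧ true  y = sym (ℚ.*-identityˡ (𝟙 y))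
𝟙-∧ false y = sym (ℚ.*-zeroˡ (𝟙 y))

ι-length-filter : ∀ {A : Set} {P : A → Set} (P? : Decidable P) xs →
  ι (length (filter P? xs)) ≡ sumℚ (map (λ x → 𝟙 (does (P? x))) xs)
ι-length-filter P? []       = refl
ι-length-filter P? (x ∷ xs) with does (P? x)
... | true  = trans (ι-+ 1 (length (filter P? xs))) (cong (_+_ 1ℚ) (ι-length-filter P? xs))
... | false = trans (ι-length-filter P? xs) (sym (ℚ.+-identityˡ _))

𝟙-all : ∀ {P : ℕ → Set} (P? : Decidable P) {n} (h : Vec ℕ n) →
  𝟙 (does (all? P? (Vec.toList h))) ≡ ∏ (λ x → 𝟙 (does (P? x))) h
𝟙-all P? []      = refl
𝟙-all P? (x ∷ h) = trans (𝟙-∧ (does (P? x)) _) (cong (_*_ (𝟙 (does (P? x)))) (𝟙-all P? h))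

module _ (f : Poly) (p : ℕ) .{{_ : NonZero p}} where

  inΩ? : Decidable (λ t → Any (λ x → eval f (+ x) %ℕ p ≡ t) (upTo p))
  inΩ? t = any? (λ x → (eval f (+ x) %ℕ p) ℕ.≟ t) (upTo p)

  χΩ : ℕ → ℚ
  χΩ t = 𝟙 (does (inΩ? t))

  _⊕_ : ℕ → ℕ → ℕ
  t ⊕ x = (t ℕ.+ x) % p

  ι-card-Ω : ι (card-Ω f p) ≡ ∑< p χΩ
  ι-card-Ω = trans (ι-length-filter inΩ? (upTo p)) (sumℚ-map-upTo χΩ p)

  ι-N : ∀ {n} (h : Vec ℕ n) → ι (N f p h) ≡ ∑< p (λ t → χΩ t * ∏ (χΩ ∘ (t ⊕_)) h)
  ι-N h = trans (ι-length-filter _ (upTo p)) (trans (sumℚ-map-upTo _ p) (∑<-cong p (λ {t} _ → split t)))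
    where
    split : ∀ t → 𝟙 (does (inΩ? t) ∧ does (all? (inΩ? ∘ (t ⊕_)) (Vec.toList h)))
                ≡ χΩ t * ∏ (χΩ ∘ (t ⊕_)) h
    split t = trans (𝟙-∧ (does (inΩ? t)) (does (all? (inΩ? ∘ (t ⊕_)) (Vec.toList h))))
                    (cong (_*_ (χΩ t)) (𝟙-all (inΩ? ∘ (t ⊕_)) h))

  ∑ᵥ-ι-N : ∀ n → ∑ᵥ p n (λ h → ι (N f p h)) ≡ ι (card-Ω f p) ^ℚ suc n
  ∑ᵥ-ι-N n = begin
    ∑ᵥ p n (λ h → ι (N f p h))
      ≡⟨ ∑ᵥ-cong p n ι-N ⟩
    ∑ᵥ p n (λ h → ∑< p (λ t → χΩ t * ∏ (χΩ ∘ (t ⊕_)) h))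
      ≡⟨ sumℚ-map-∑< p (λ h t → χΩ t * ∏ (χΩ ∘ (t ⊕_)) h) (allVecs p n) ⟩
    ∑< p (λ t → ∑ᵥ p n (λ h → χΩ t * ∏ (χΩ ∘ (t ⊕_)) h))
      ≡⟨ ∑<-cong p (λ {t} _ → sumℚ-map-*ˡ (χΩ t) (∏ (χΩ ∘ (t ⊕_))) (allVecs p n)) ⟩
    ∑< p (λ t → χΩ t * ∑ᵥ p n (∏ (χΩ ∘ (t ⊕_))))
      ≡⟨ ∑<-cong p (λ {t} _ → cong (_*_ (χΩ t))
           (trans (∑ᵥ-∏ p n (χΩ ∘ (t ⊕_))) (cong (_^ℚ n) (∑<-shift p t χΩ)))) ⟩
    ∑< p (λ t → χΩ t * ∑< p χΩ ^ℚ n)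
      ≡⟨ sym (*-distribʳ-sum {p} (∑< p χΩ ^ℚ n) (χΩ ∘ toℕ)) ⟩
    ∑< p χΩ ^ℚ suc n
      ≡⟨ cong (_^ℚ suc n) (sym ι-card-Ω) ⟩
    ι (card-Ω f p) ^ℚ suc n ∎

-- εp with |Ω_p| as an explicit argument, so that proofs can case on it.
εWithCard : (f : Poly) (k p : ℕ) .{{_ : NonZero p}} → ℕ → Vec ℕ (k ∸ 1) → ℚ
εWithCard f k p zero    h = 0ℚ
εWithCard f k p (suc c) h = (+ p / suc c) ^ℚ (k ∸ 1) * (+ N f p h / suc c) - 1ℚ

εp≡εWithCard : ∀ f k p .{{_ : NonZero p}} h → εp f k p h ≡ εWithCard f k p (card-Ω f p) h
εp≡εWithCard f k p h with card-Ω f p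
... | zero  = refl
... | suc c = refl

∑ᵥ-εp≡0 : ∀ f k p .{{_ : NonZero p}} → ∑ᵥ p (k ∸ 1) (εp f k p) ≡ 0ℚ
∑ᵥ-εp≡0 f k p = trans (∑ᵥ-cong p n (εp≡εWithCard f k p)) (vanish (card-Ω f p) (∑ᵥ-ι-N f p n))
  where
  n = k ∸ 1
  vanish : ∀ C → ∑ᵥ p n (λ h → ι (N f p h)) ≡ ι C ^ℚ suc n → ∑ᵥ p n (εWithCard f k p C) ≡ 0ℚ
  vanish zero    _  = sumℚ-map-0 (allVecs p n)
  vanish (suc c) ∑N = begin
    ∑ᵥ p n (λ h → K * (+ N f p h / suc c) - 1ℚ)
      ≡⟨ sumℚ-map-− (λ h → K * (+ N f p h / suc c)) (λ _ → 1ℚ) (allVecs p n) ⟩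
    ∑ᵥ p n (λ h → K * (+ N f p h / suc c)) - ∑ᵥ p n (λ _ → 1ℚ)
      ≡⟨ cong₂ _-_ (sumℚ-map-*ˡ K (λ h → + N f p h / suc c) (allVecs p n)) (∑ᵥ-1 p n) ⟩
    K * ∑ᵥ p n (λ h → + N f p h / suc c) - ι p ^ℚ n
      ≡⟨ cong (λ s → K * s - ι p ^ℚ n) (trans (∑ᵥ-cong p n (λ h → n/d≡1/d*ι[n] (N f p h) c))
                                               (sumℚ-map-*ˡ R (λ h → ι (N f p h)) (allVecs p n))) ⟩
    K * (R * ∑ᵥ p n (λ h → ι (N f p h))) - ι p ^ℚ n
      ≡⟨ cong₂ (λ K′ s → K′ * (R * s) - ι p ^ℚ n) (cong (_^ℚ n) (n/d≡1/d*ι[n] p c)) ∑N ⟩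
    (R * ι p) ^ℚ n * (R * ι (suc c) ^ℚ suc n) - ι p ^ℚ n
      ≡⟨ cong (_- ι p ^ℚ n) (^ℚ-cancel (ι p) {R} {ι (suc c)} n (1/d*ι[d]≡1 c)) ⟩
    ι p ^ℚ n - ι p ^ℚ n
      ≡⟨ ℚ.+-inverseʳ (ι p ^ℚ n) ⟩
    0ℚ ∎
    where
    K = (+ p / suc c) ^ℚ n
    R = + 1 / suc c

-- Squarefree moduli

reduce-reduce : ∀ p m .{{_ : NonZero p}} .{{_ : NonZero m}} → p ∣ m → ∀ {n} (h : Vec ℕ n) →
                reduce p (reduce m h) ≡ reduce p h
reduce-reduce p m p∣m []      = refl
reduce-reduce p m p∣m (x ∷ h) = cong₂ _∷_ (m∣n⇒o%n%m≡o%m p m x p∣m) (reduce-reduce p m p∣m h)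

εL : (f : Poly) (k : ℕ) → List ℕ → Vec ℕ (k ∸ 1) → ℚ
εL f k qs h = List.foldr (λ q acc → εp f k (2 ℕ.+ q) (reduce (2 ℕ.+ q) h) * acc) 1ℚ qs

εL-reduce : ∀ f k m .{{_ : NonZero m}} {qs} → All (λ q → 2 ℕ.+ q ∣ m) qs → ∀ h →
            εL f k qs (reduce m h) ≡ εL f k qs h
εL-reduce f k m []                h = refl
εL-reduce f k m {q ∷ _} (p∣m ∷ qs∣m) h =
  cong₂ _*_ (cong (εp f k (2 ℕ.+ q)) (reduce-reduce (2 ℕ.+ q) m p∣m h)) (εL-reduce f k m qs∣m h)

prime∤⇒coprime : ∀ {m p} → Prime p → p ∤ m → Coprime m p
prime∤⇒coprime p-prime p∤m (i∣m , i∣p) with prime⇒irreducible p-prime i∣p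
... | inj₁ i≡1 = i≡1
... | inj₂ refl = contradiction i∣m p∤m

prime∣m*p⇒∣m : ∀ {r m p} → Prime r → Prime p → r ≢ p → r ∣ m ℕ.* p → r ∣ m
prime∣m*p⇒∣m {m = m} {p} r-prime p-prime r≢p r∣m*p with euclidsLemma m p r-prime r∣m*p
... | inj₁ r∣m = r∣m
... | inj₂ r∣p with prime⇒irreducible p-prime r∣p
...   | inj₁ refl = contradiction r-prime ¬prime[1]
...   | inj₂ r≡p  = contradiction r≡p r≢p

PrimeDivisorPred : ℕ → ℕ → Set
PrimeDivisorPred d q = Prime (2 ℕ.+ q) × 2 ℕ.+ q ∣ d

primeDivisorPred? : ∀ d → Decidable (PrimeDivisorPred d)
primeDivisorPred? d q = prime? (2 ℕ.+ q) ×-dec (2 ℕ.+ q) ∣? d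

∑ᵥ-εL≡0 : ∀ f k {d} .{{_ : NonZero d}} → SquareFree d → ∀ qs → qs ≢ [] →
          All (PrimeDivisorPred d) qs → Unique qs → ∑ᵥ d (k ∸ 1) (εL f k qs) ≡ 0ℚ
∑ᵥ-εL≡0 f k sqf []       []≢[] _ _ = contradiction refl []≢[]
∑ᵥ-εL≡0 f k {d} sqf (q ∷ qs) _ ((p-prime , p∣d) ∷ qs-prime) (q∉qs ∷ _) = begin
  ∑ᵥ d n (εL f k (q ∷ qs))
    ≡⟨ ∑ᵥ-cong d n (λ h → cong (_*_ (εp f k p (reduce p h))) (sym (εL-reduce f k m qs∣m h))) ⟩
  ∑ᵥ d n (λ h → εp f k p (reduce p h) * εL f k qs (reduce m h))
    ≡⟨ cong (λ d′ → ∑ᵥ d′ n (λ h → εp f k p (reduce p h) * εL f k qs (reduce m h))) d≡m*p ⟩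
  ∑ᵥ (m ℕ.* p) n (λ h → εp f k p (reduce p h) * εL f k qs (reduce m h))
    ≡⟨ ∑ᵥ-CRT m p (prime∤⇒coprime p-prime p∤m) n (εp f k p) (εL f k qs) ⟩
  ∑ᵥ p n (εp f k p) * ∑ᵥ m n (εL f k qs)
    ≡⟨ cong (_* ∑ᵥ m n (εL f k qs)) (∑ᵥ-εp≡0 f k p) ⟩
  0ℚ * ∑ᵥ m n (εL f k qs)
    ≡⟨ ℚ.*-zeroˡ (∑ᵥ m n (εL f k qs)) ⟩
  0ℚ ∎
  where
  n = k ∸ 1
  p = 2 ℕ.+ q
  m = quotient p∣d
  instance
    m≢0 : NonZero m
    m≢0 = quotient≢0 p∣d
  d≡m*p : d ≡ m ℕ.* p
  d≡m*p = m∣n⇒n≡quotient*m p∣d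
  p∤m : p ∤ m
  p∤m p∣m = sqf p p-prime (subst (p ℕ.* p ∣_) (sym d≡m*p) (*-monoˡ-∣ p p∣m))
  qs∣m : All (λ q′ → 2 ℕ.+ q′ ∣ m) qs
  qs∣m = All.zipWith divides-m (qs-prime , q∉qs)
    where
    divides-m : ∀ {q′} → PrimeDivisorPred d q′ × q ≢ q′ → 2 ℕ.+ q′ ∣ m
    divides-m ((r-prime , r∣d) , q≢q′) = prime∣m*p⇒∣m r-prime p-prime
      (λ r≡p → q≢q′ (sym (ℕ.+-cancelˡ-≡ 2 _ _ r≡p))) (subst (_ ∣_) d≡m*p r∣d)

prime-divisor : ∀ {d} → 1 < d → ∃ λ p → Prime p × p ∣ d
prime-divisor {d@(suc _)} 1<d with factorise d
... | record { factors = [] ; isFactorisation = d≡1 } = contradiction 1<d (ℕ.<-irrefl (sym d≡1))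
... | record { factors = p ∷ ps ; isFactorisation = d≡∏ ; factorsPrime = p-prime ∷ _ } =
  p , p-prime , subst (p ∣_) (sym d≡∏) (m∣m*n (product ps))

primeDivisorsPred-sound : ∀ d → All (PrimeDivisorPred d) (primeDivisorsPred d)
primeDivisorsPred-sound d = all-filter (primeDivisorPred? d) (upTo d)

primeDivisorsPred-unique : ∀ d → Unique (primeDivisorsPred d)
primeDivisorsPred-unique d = filter⁺ (primeDivisorPred? d) (upTo⁺ d)

primeDivisorsPred-nonempty : ∀ {d} → 1 < d → primeDivisorsPred d ≢ []
primeDivisorsPred-nonempty {d@(suc _)} 1<d none with prime-divisor 1<d
... | zero        , 0-prime , _   = ¬prime[0] 0-prime
... | suc zero    , 1-prime , _   = ¬prime[1] 1-prime
... | suc (suc q) , p-prime , p∣d =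
  case subst (q ∈_) none (∈-filter⁺ (primeDivisorPred? d) (∈-upTo⁺ q<d) (p-prime , p∣d)) of λ ()
  where
  q<d : q < d
  q<d = ℕ.<-≤-trans (ℕ.m<n+m q (ℕ.s≤s ℕ.z≤n)) (∣⇒≤ p∣d)

lemma19 : (f : Poly) (k d : ℕ) → 2 ≤ k → 1 < d → SquareFree d →
    sumℚ (map (εd f k d) (allVecs d (k ∸ 1))) ≡ 0ℚ
lemma19 f k d _ 1<d sqf =
  ∑ᵥ-εL≡0 f k {{ℕ.>-nonZero (ℕ.<⇒≤ 1<d)}} sqf (primeDivisorsPred d) (primeDivisorsPred-nonempty 1<d)
    (primeDivisorsPred-sound d) (primeDivisorsPred-unique d)
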